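{- Greedy-Ratio is an $\mathcal{O}(\sqrt{\Delta^r})$-approximation algorithm for MCDS: there is an absolute constant $C$ such that for every graph $G$ with maximum degree $\Delta\ge 1$, every $r\in\mathbb{N}$, and every execution of Greedy-Ratio on $(G,r)$ (with any tie-breaking), the output $D$ is an $r$-dominating set whose average $r$-congestion is at most $C\sqrt{\Delta^r}\cdot \mathrm{mac}^r(G)$.
   Context: Graphs are finite, simple, undirected; $\Delta$ is the maximum degree; $N^r[v]$ is the set of vertices at distance at most $r$ from $v$, $N^r[X]=\bigcup_{x\in X}N^r[x]$. $D$ is $r$-dominating if $N^r[D]=V$. The average $r$-congestion of $S\subseteq V$ is $\frac{1}{|V|}\sum_{v\in V}|N^r[v]\cap S|$, and $\mathrm{mac}^r(G)$ is its minimum over $r$-dominating sets; MCDS asks for an $r$-dominating set attaining it. Greedy-Ratio: start with $D=\emptyset$; while $D$ is not $r$-dominating, add to $D$ a vertex $v$ maximizing $\frac{|N^r[v]\setminus N^r[D]|}{|N^r[v]|}$, breaking ties arbitrarily; output $D$. -}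

module Defs where

open import Data.Nat using (ℕ; zero; suc; _+_; _*_; _^_; _≤_; _⊔_)
open import Data.Bool using (Bool; true; false; _∧_; _∨_; T)
open import Data.Fin using (Fin)
open import Data.List using (List; foldr; map; allFin)
open import Data.Bool.ListAction using (any)
open import Data.Nat.ListAction using (sum)
open import Data.Vec using (tabulate; lookup)
open import Data.Fin.Subset using (Subset; ⁅_⁆; _∪_; _∩_; _─_; ∣_∣; ⊥; _∈_)
open import Relation.Binary.PropositionalEquality using (_≡_)
open import Relation.Nullary using (¬_)
open import Data.Product using (_×_; Σ-syntax)

record Graph (n : ℕ) : Set where
  field
    adj     : Fin n → Fin n → Bool
    symm    : ∀ u v → adj u v ≡ adj v u
    irrefl  : ∀ v → adj v v ≡ false
open Graph public

module _ {n : ℕ} (G : Graph n) where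

  nbrs : Fin n → Subset n
  nbrs v = tabulate (λ u → adj G v u)

  degree : Fin n → ℕ
  degree v = ∣ nbrs v ∣

  maxDeg : ℕ
  maxDeg = foldr (λ v m → degree v ⊔ m) 0 (allFin n)

  step : Subset n → Subset n
  step S = S ∪ tabulate (λ u → any (λ w → lookup S w ∧ adj G w u) (allFin n))

  ball : ℕ → Fin n → Subset n
  ball zero    v = ⁅ v ⁆
  ball (suc r) v = step (ball r v)

  ballSet : ℕ → Subset n → Subset n
  ballSet r X = tabulate (λ u → any (λ x → lookup X x ∧ lookup (ball r x) u) (allFin n))

  Dominating : ℕ → Subset n → Set
  Dominating r D = ∀ u → u ∈ ballSet r D

  -- total r-congestion  Σ_v |N^r[v] ∩ S|  (= |V| · average r-congestion)
  congestion : ℕ → Subset n → ℕ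
  congestion r S = sum (map (λ v → ∣ ball r v ∩ S ∣) (allFin n))

  -- m is the minimum total r-congestion over r-dominating sets
  -- (so m / |V| = mac^r(G))
  IsMinCongestion : ℕ → ℕ → Set
  IsMinCongestion r m =
    (Σ[ S ∈ Subset n ] (Dominating r S × congestion r S ≡ m))
    × (∀ S → Dominating r S → m ≤ congestion r S)

  gain : ℕ → Subset n → Fin n → ℕ
  gain r D v = ∣ ball r v ─ ballSet r D ∣

  size : ℕ → Fin n → ℕ
  size r v = ∣ ball r v ∣

  -- v maximises |N^r[v] \ N^r[D]| / |N^r[v]| (cross-multiplied; sizes are positive)
  MaximisesRatio : ℕ → Subset n → Fin n → Set
  MaximisesRatio r D v = ∀ u → gain r D u * size r v ≤ gain r D v * size r u

  -- GreedyRun r D out : an execution of Greedy-Ratio from current set D ends with output out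
  -- (any tie-breaking: any maximiser may be chosen at each step)
  data GreedyRun (r : ℕ) : Subset n → Subset n → Set where
    done : ∀ {D} → Dominating r D → GreedyRun r D D
    add  : ∀ {D out} (v : Fin n) → ¬ Dominating r D → MaximisesRatio r D v →
           GreedyRun r (D ∪ ⁅ v ⁆) out → GreedyRun r D out

module Submission where

-- Every ball N^r[v] has at most 2Δ^r vertices: beyond radius 1 each vertex of the outermost layer
-- has a neighbour further in, so one more step multiplies the ball by at most Δ.
-- Fix an r-dominating S of congestion O. Congestion is additive over vertices, a vertex x costing
-- |N^r[x]|, and since the balls around S cover the U still uncovered vertices, the greedy choice
-- pays at most O / U per newly covered vertex. While U ≥ O / K this is at most K, so this phase
-- costs at most K·n ≤ K·O; the rest costs at most 2Δ^r per uncovered vertex, i.e. less than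
-- 2Δ^r·O / K. With K² ≈ 2Δ^r the greedy output has congestion at most 2K·O ≤ 6 √(Δ^r) · O.

open import Defs

open import Data.Bool using (Bool; true; false; T; not; _∧_; _∨_)
open import Data.Bool.ListAction using (any)
open import Data.Bool.Properties using (T-≡; T-∧; T-∨)
open import Data.Empty using (⊥-elim)
open import Data.Fin using (Fin; zero; suc)
open import Data.Fin.Properties using (¬∀⟶∃¬)
open import Data.Fin.Subset using (Subset; ⁅_⁆; _∪_; _∩_; _─_; ∣_∣; _∈_; ⊥)
open import Data.Fin.Subset.Properties using (x∈⁅x⁆; x∈⁅y⁆⇒x≡y; ∣⁅x⁆∣≡1)
open import Data.List using (_∷_; foldr; allFin; tabulate)
open import Data.List.Membership.Propositional using (lose) renaming (_∈_ to _∈ᴸ_)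
open import Data.List.Membership.Propositional.Properties using (∈-allFin)
open import Data.List.Properties using (map-tabulate)
open import Data.List.Relation.Unary.Any using (here; there; satisfied)
open import Data.List.Relation.Unary.Any.Properties using (any⁺; any⁻)
open import Data.Nat using (ℕ; zero; suc; _+_; _*_; _∸_; _^_; _≤_; _≤?_; _⊔_; z≤n; s≤s; NonZero; >-nonZero)
open import Data.Nat.ListAction using (sum)
open import Data.Nat.Properties
open import Algebra.Properties.Semiring.Sum +-*-semiring using (sum-syntax; sum-cong-≗; ∑-distrib-+; ∑-comm; *-distribˡ-sum)
open import Data.Nat.Tactic.RingSolver using (solve-∀)
open import Data.Product using (_×_; _,_; proj₁; proj₂; ∃-syntax; Σ-syntax)
open import Data.Sum using (_⊎_; inj₁; inj₂)
open import Data.Vec using ([]; _∷_; lookup)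
open import Data.Vec.Properties using (lookup∘tabulate; lookup-zipWith; lookup-replicate; []=⇒lookup; lookup⇒[]=)
open import Function using (_⇔_; mk⇔; Equivalence)
open import Relation.Binary.PropositionalEquality using (_≡_; refl; sym; trans; cong; cong₂; subst; module ≡-Reasoning)
open import Relation.Nullary using (¬_; T?; yes; no)

-- Indicators and counting

𝟙 : Bool → ℕ
𝟙 true  = 1
𝟙 false = 0

T⇒𝟙≡1 : ∀ {a} → T a → 𝟙 a ≡ 1
T⇒𝟙≡1 {true} _ = refl

𝟙≤1 : ∀ a → 𝟙 a ≤ 1
𝟙≤1 true  = ≤-refl
𝟙≤1 false = z≤n

𝟙≤ : ∀ {a m} → (T a → 1 ≤ m) → 𝟙 a ≤ m
𝟙≤ {true}  h = h _
𝟙≤ {false} h = z≤n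

𝟙-mono : ∀ {a b} → (T a → T b) → 𝟙 a ≤ 𝟙 b
𝟙-mono a⇒b = 𝟙≤ (λ ta → ≤-reflexive (sym (T⇒𝟙≡1 (a⇒b ta))))

𝟙-cong : ∀ {a b} → (T a → T b) → (T b → T a) → 𝟙 a ≡ 𝟙 b
𝟙-cong a⇒b b⇒a = ≤-antisym (𝟙-mono a⇒b) (𝟙-mono b⇒a)

𝟙-∧ : ∀ a b → 𝟙 (a ∧ b) ≡ 𝟙 a * 𝟙 b
𝟙-∧ true  b = sym (+-identityʳ (𝟙 b))
𝟙-∧ false b = refl

𝟙-∨ : ∀ a b → 𝟙 (a ∨ b) ≤ 𝟙 a + 𝟙 b
𝟙-∨ true  b = s≤s z≤n
𝟙-∨ false b = ≤-refl

𝟙-split : ∀ a b → 𝟙 a ≡ 𝟙 (a ∧ b) + 𝟙 (a ∧ not b)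
𝟙-split true  true  = refl
𝟙-split true  false = refl
𝟙-split false b     = refl

𝟙-disjoint : ∀ a b c → (T a → T c) → (T b → T c) → (T a → ¬ T b) → 𝟙 a + 𝟙 b ≤ 𝟙 c
𝟙-disjoint true  true  _ _   _   a∩b = ⊥-elim (a∩b _ _)
𝟙-disjoint true  false c a⇒c _   _   = 𝟙-mono {true} a⇒c
𝟙-disjoint false b     c _   b⇒c _   = 𝟙-mono b⇒c

𝟙-*-≤ : ∀ a {m d} → (T a → m ≤ d) → 𝟙 a * m ≤ d * 𝟙 a
𝟙-*-≤ true  {m} {d} h = ≤-trans (≤-reflexive (*-identityˡ m)) (≤-trans (h _) (≤-reflexive (sym (*-identityʳ d))))
𝟙-*-≤ false         h = z≤n

T-∧ˡ : ∀ a {b} → T (a ∧ b) → T a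
T-∧ˡ true _ = _

T-∧ʳ : ∀ a {b} → T (a ∧ b) → T b
T-∧ʳ true t = t

T-not⇒¬T : ∀ {a} → T (not a) → ¬ T a
T-not⇒¬T {false} _ ()

¬T⇒T-not : ∀ {a} → ¬ T a → T (not a)
¬T⇒T-not {false} _  = _
¬T⇒T-not {true}  ¬t = ⊥-elim (¬t _)

∧-not⁺ : ∀ {a b} → T a → ¬ T b → T (a ∧ not b)
∧-not⁺ {true} {false} _ _   = _
∧-not⁺ {true} {true}  _ ¬tb = ⊥-elim (¬tb _)

∧-not⁻ : ∀ {a b} → T (a ∧ not b) → T a × ¬ T b
∧-not⁻ {true} {false} _ = _ , λ ()

∑-mono-≤ : ∀ {n} {f g : Fin n → ℕ} → (∀ i → f i ≤ g i) → ∑[ i < n ] f i ≤ ∑[ i < n ] g i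
∑-mono-≤ {zero}  f≤g = z≤n
∑-mono-≤ {suc n} f≤g = +-mono-≤ (f≤g zero) (∑-mono-≤ (λ i → f≤g (suc i)))

≤-∑ : ∀ {n} (f : Fin n → ℕ) i → f i ≤ ∑[ j < n ] f j
≤-∑ f zero    = m≤m+n _ _
≤-∑ f (suc i) = ≤-trans (≤-∑ (λ j → f (suc j)) i) (m≤n+m _ (f zero))

∑-const : ∀ n c → ∑[ i < n ] c ≡ n * c
∑-const zero    c = refl
∑-const (suc n) c = cong (c +_) (∑-const n c)

∑𝟙≤n : ∀ {n} (p : Fin n → Bool) → ∑[ i < n ] 𝟙 (p i) ≤ n
∑𝟙≤n {n} p = ≤-trans (∑-mono-≤ (λ i → 𝟙≤1 (p i))) (≤-reflexive (trans (∑-const n 1) (*-identityʳ n)))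

T⇒1≤∑𝟙 : ∀ {n} (p : Fin n → Bool) i → T (p i) → 1 ≤ ∑[ j < n ] 𝟙 (p j)
T⇒1≤∑𝟙 p i pi = ≤-trans (≤-reflexive (sym (T⇒𝟙≡1 pi))) (≤-∑ (λ j → 𝟙 (p j)) i)

∑𝟙-mono : ∀ {n} (p q : Fin n → Bool) → (∀ i → T (p i) → T (q i)) →
  ∑[ i < n ] 𝟙 (p i) ≤ ∑[ i < n ] 𝟙 (q i)
∑𝟙-mono p q p⇒q = ∑-mono-≤ (λ i → 𝟙-mono (p⇒q i))

∑𝟙-split : ∀ {n} (p q : Fin n → Bool) →
  ∑[ i < n ] 𝟙 (p i) ≡ ∑[ i < n ] 𝟙 (p i ∧ q i) + ∑[ i < n ] 𝟙 (p i ∧ not (q i))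
∑𝟙-split p q = trans (sum-cong-≗ (λ i → 𝟙-split (p i) (q i)))
                     (∑-distrib-+ (λ i → 𝟙 (p i ∧ q i)) (λ i → 𝟙 (p i ∧ not (q i))))

union-bound : ∀ {n} (p q : Fin n → Bool) (R : Fin n → Fin n → Bool) →
  (∀ u → T (q u) → ∃[ w ] (T (p w) × T (R w u))) →
  ∑[ u < n ] 𝟙 (q u) ≤ ∑[ w < n ] (𝟙 (p w) * ∑[ u < n ] 𝟙 (R w u ∧ q u))
union-bound {n} p q R cover = begin
  ∑[ u < n ] 𝟙 (q u)
    ≤⟨ ∑-mono-≤ covered ⟩
  ∑[ u < n ] ∑[ w < n ] (𝟙 (p w) * 𝟙 (R w u ∧ q u))
    ≡⟨ ∑-comm (λ u w → 𝟙 (p w) * 𝟙 (R w u ∧ q u)) ⟩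
  ∑[ w < n ] ∑[ u < n ] (𝟙 (p w) * 𝟙 (R w u ∧ q u))
    ≡⟨ sum-cong-≗ (λ w → sym (*-distribˡ-sum (𝟙 (p w)) (λ u → 𝟙 (R w u ∧ q u)))) ⟩
  ∑[ w < n ] (𝟙 (p w) * ∑[ u < n ] 𝟙 (R w u ∧ q u)) ∎
  where
  open ≤-Reasoning
  covered : ∀ u → 𝟙 (q u) ≤ ∑[ w < n ] (𝟙 (p w) * 𝟙 (R w u ∧ q u))
  covered u = 𝟙≤ (λ qu → witnessed qu (cover u qu))
    where
    witnessed : T (q u) → ∃[ w ] (T (p w) × T (R w u)) → 1 ≤ ∑[ w < n ] (𝟙 (p w) * 𝟙 (R w u ∧ q u))
    witnessed qu (w , pw , Rwu) = ≤-trans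
      (≤-reflexive (sym (cong₂ _*_ (T⇒𝟙≡1 pw) (T⇒𝟙≡1 (Equivalence.from T-∧ (Rwu , qu))))))
      (≤-∑ (λ w → 𝟙 (p w) * 𝟙 (R w u ∧ q u)) w)

∑-tabulate : ∀ {n} (f : Fin n → ℕ) → sum (tabulate f) ≡ ∑[ i < n ] f i
∑-tabulate {zero}  f = refl
∑-tabulate {suc n} f = cong (f zero +_) (∑-tabulate (λ i → f (suc i)))

T-any-allFin : ∀ {n} (p : Fin n → Bool) → T (any p (allFin n)) ⇔ (∃[ i ] T (p i))
T-any-allFin p = mk⇔ (λ t → satisfied (any⁻ p (allFin _) t))
                     (λ (i , pi) → any⁺ p (lose (∈-allFin i) pi))

≤-foldr-⊔ : ∀ {A : Set} (f : A → ℕ) {x xs} → x ∈ᴸ xs → f x ≤ foldr (λ y m → f y ⊔ m) 0 xs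
≤-foldr-⊔ f (here refl) = m≤m⊔n _ _
≤-foldr-⊔ f {xs = y ∷ _} (there x∈xs) = ≤-trans (≤-foldr-⊔ f x∈xs) (m≤n⊔m (f y) _)

-- Subsets as Boolean vectors

∈⇔T-lookup : ∀ {n} {p : Subset n} {x} → x ∈ p ⇔ T (lookup p x)
∈⇔T-lookup {p = p} {x} = mk⇔ (λ x∈p → Equivalence.from T-≡ ([]=⇒lookup x∈p))
                             (λ t → lookup⇒[]= x p (Equivalence.to T-≡ t))

lookup-∪ : ∀ {n} (p q : Subset n) i → lookup (p ∪ q) i ≡ lookup p i ∨ lookup q i
lookup-∪ p q i = lookup-zipWith _∨_ i p q

lookup-∩ : ∀ {n} (p q : Subset n) i → lookup (p ∩ q) i ≡ lookup p i ∧ lookup q i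
lookup-∩ p q i = lookup-zipWith _∧_ i p q

lookup-─ : ∀ {n} (p q : Subset n) i → lookup (p ─ q) i ≡ lookup p i ∧ not (lookup q i)
lookup-─ (true  ∷ p) (true  ∷ q) zero    = refl
lookup-─ (true  ∷ p) (false ∷ q) zero    = refl
lookup-─ (false ∷ p) (true  ∷ q) zero    = refl
lookup-─ (false ∷ p) (false ∷ q) zero    = refl
lookup-─ (_     ∷ p) (_     ∷ q) (suc i) = lookup-─ p q i

∣p∣≡∑𝟙 : ∀ {n} (p : Subset n) → ∣ p ∣ ≡ ∑[ i < n ] 𝟙 (lookup p i)
∣p∣≡∑𝟙 []          = refl
∣p∣≡∑𝟙 (true  ∷ p) = cong suc (∣p∣≡∑𝟙 p)
∣p∣≡∑𝟙 (false ∷ p) = ∣p∣≡∑𝟙 p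

weight : ∀ {n} → (Fin n → ℕ) → Subset n → ℕ
weight {n} f S = ∑[ x < n ] (𝟙 (lookup S x) * f x)

weight-⊥ : ∀ {n} (f : Fin n → ℕ) → weight f ⊥ ≡ 0
weight-⊥ {n} f = trans (sum-cong-≗ (λ x → cong (λ b → 𝟙 b * f x) (lookup-replicate x false)))
                       (trans (∑-const n 0) (*-zeroʳ n))

weight-⁅⁆ : ∀ {n} (f : Fin n → ℕ) v → weight f ⁅ v ⁆ ≡ f v
weight-⁅⁆ f zero    = trans (cong₂ _+_ (*-identityˡ (f zero)) (weight-⊥ (λ x → f (suc x)))) (+-identityʳ _)
weight-⁅⁆ f (suc v) = weight-⁅⁆ (λ x → f (suc x)) v

weight-∪ : ∀ {n} (f : Fin n → ℕ) S S′ → weight f (S ∪ S′) ≤ weight f S + weight f S′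
weight-∪ {n} f S S′ = begin
  weight f (S ∪ S′)
    ≤⟨ ∑-mono-≤ pointwise ⟩
  ∑[ x < n ] (𝟙 (lookup S x) * f x + 𝟙 (lookup S′ x) * f x)
    ≡⟨ ∑-distrib-+ (λ x → 𝟙 (lookup S x) * f x) _ ⟩
  weight f S + weight f S′ ∎
  where
  open ≤-Reasoning
  pointwise : ∀ x → 𝟙 (lookup (S ∪ S′) x) * f x ≤ 𝟙 (lookup S x) * f x + 𝟙 (lookup S′ x) * f x
  pointwise x rewrite lookup-∪ S S′ x | sym (*-distribʳ-+ (f x) (𝟙 (lookup S x)) (𝟙 (lookup S′ x))) =
    *-monoˡ-≤ (f x) (𝟙-∨ (lookup S x) (lookup S′ x))

weight-mono : ∀ {n} {f g : Fin n → ℕ} → (∀ x → f x ≤ g x) → ∀ S → weight f S ≤ weight g S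
weight-mono f≤g S = ∑-mono-≤ (λ x → *-monoʳ-≤ (𝟙 (lookup S x)) (f≤g x))

*-weight : ∀ {n} c (f : Fin n → ℕ) S → c * weight f S ≡ weight (λ x → c * f x) S
*-weight c f S = trans (*-distribˡ-sum c (λ x → 𝟙 (lookup S x) * f x))
                       (sum-cong-≗ (λ x → x*[y*z]≡y*[x*z] c (𝟙 (lookup S x)) (f x)))
  where
  x*[y*z]≡y*[x*z] : ∀ x y z → x * (y * z) ≡ y * (x * z)
  x*[y*z]≡y*[x*z] = solve-∀

-- Balls

module _ {n : ℕ} (G : Graph n) where

  Adj : Fin n → Fin n → Set
  Adj v u = T (adj G v u)

  Adj-sym : ∀ {v u} → Adj v u → Adj u v
  Adj-sym {v} {u} = subst T (symm G v u)

  near : ℕ → Fin n → Fin n → Bool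
  near r v = lookup (ball G r v)

  lookup-step : ∀ S u → lookup (step G S) u ≡ lookup S u ∨ any (λ w → lookup S w ∧ adj G w u) (allFin n)
  lookup-step S u = trans (lookup-∪ S _ u) (cong (lookup S u ∨_) (lookup∘tabulate _ u))

  near-suc⁻ : ∀ {r v u} → T (near (suc r) v u) → T (near r v u) ⊎ ∃[ w ] (T (near r v w) × Adj w u)
  near-suc⁻ {r} {v} {u} t with Equivalence.to T-∨ (subst T (lookup-step (ball G r v) u) t)
  ... | inj₁ x = inj₁ x
  ... | inj₂ y with Equivalence.to (T-any-allFin _) y
  ...   | w , x = inj₂ (w , Equivalence.to T-∧ x)

  near-suc⁺ : ∀ {r v u} → T (near r v u) ⊎ ∃[ w ] (T (near r v w) × Adj w u) → T (near (suc r) v u)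
  near-suc⁺ {r} {v} {u} h = subst T (sym (lookup-step (ball G r v) u)) (Equivalence.from T-∨ (reach h))
    where
    reach : _ → T (near r v u) ⊎ T (any (λ w → lookup (ball G r v) w ∧ adj G w u) (allFin n))
    reach (inj₁ x)           = inj₁ x
    reach (inj₂ (w , x , a)) = inj₂ (Equivalence.from (T-any-allFin _) (w , Equivalence.from T-∧ (x , a)))

  near-zero⁻ : ∀ {v u} → T (near 0 v u) → v ≡ u
  near-zero⁻ {v} t = sym (x∈⁅y⁆⇒x≡y v (Equivalence.from ∈⇔T-lookup t))

  near-refl : ∀ r v → T (near r v v)
  near-refl zero    v = Equivalence.to ∈⇔T-lookup (x∈⁅x⁆ v)
  near-refl (suc r) v = near-suc⁺ {r} (inj₁ (near-refl r v))

  near-adj : ∀ r {v w u} → Adj v w → T (near r w u) → T (near (suc r) v u)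
  near-adj zero {v} {w} {u} a x with near-zero⁻ {w} {u} x
  ... | refl = near-suc⁺ {0} {v} {u} (inj₂ (v , near-refl 0 v , a))
  near-adj (suc r) {v} {w} {u} a x with near-suc⁻ {r} {w} {u} x
  ... | inj₁ y            = near-suc⁺ {suc r} (inj₁ (near-adj r a y))
  ... | inj₂ (w′ , y , b) = near-suc⁺ {suc r} (inj₂ (w′ , near-adj r a y , b))

  near-sym : ∀ r {v u} → T (near r v u) → T (near r u v)
  near-sym zero {v} {u} x with near-zero⁻ {v} {u} x
  ... | refl = near-refl 0 v
  near-sym (suc r) {v} {u} x with near-suc⁻ {r} {v} {u} x
  ... | inj₁ y           = near-suc⁺ {r} (inj₁ (near-sym r y))
  ... | inj₂ (w , y , a) = near-adj r (Adj-sym a) (near-sym r y)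

  layer : ℕ → Fin n → Fin n → Bool
  layer r v u = near (suc r) v u ∧ not (near r v u)

  layer-cover : ∀ r v u → T (layer r v u) → ∃[ w ] (T (near r v w) × Adj w u)
  layer-cover r v u t with ∧-not⁻ t
  ... | x , ¬y with near-suc⁻ {r} {v} {u} x
  ...   | inj₁ y = ⊥-elim (¬y y)
  ...   | inj₂ w = w

  size≡∑ : ∀ r v → size G r v ≡ ∑[ u < n ] 𝟙 (near r v u)
  size≡∑ r v = ∣p∣≡∑𝟙 (ball G r v)

  degree≡∑ : ∀ v → degree G v ≡ ∑[ u < n ] 𝟙 (adj G v u)
  degree≡∑ v = trans (∣p∣≡∑𝟙 (nbrs G v)) (sum-cong-≗ (λ u → cong 𝟙 (lookup∘tabulate (adj G v) u)))

  degree≤maxDeg : ∀ v → degree G v ≤ maxDeg G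
  degree≤maxDeg v = ≤-foldr-⊔ (degree G) (∈-allFin v)

  outside-neighbours≤ : ∀ (A : Fin n → Bool) {w x} → Adj w x → T (A x) →
    ∑[ u < n ] 𝟙 (adj G w u ∧ not (A u)) ≤ maxDeg G ∸ 1
  outside-neighbours≤ A {w} {x} a ax = ∸-monoˡ-≤ 1 (begin
    1 + ∑[ u < n ] 𝟙 (adj G w u ∧ not (A u))
      ≤⟨ +-monoˡ-≤ _ (T⇒1≤∑𝟙 (λ u → adj G w u ∧ A u) x (Equivalence.from T-∧ (a , ax))) ⟩
    ∑[ u < n ] 𝟙 (adj G w u ∧ A u) + ∑[ u < n ] 𝟙 (adj G w u ∧ not (A u))
      ≡⟨ sym (∑𝟙-split (adj G w) A) ⟩
    ∑[ u < n ] 𝟙 (adj G w u)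
      ≡⟨ sym (degree≡∑ w) ⟩
    degree G w
      ≤⟨ degree≤maxDeg w ⟩
    maxDeg G ∎)
    where open ≤-Reasoning

  size-suc≤ : ∀ r v (F : Fin n → Bool) d →
    (∀ u → T (layer r v u) → ∃[ w ] (T (F w) × Adj w u)) →
    (∀ w → T (F w) → ∑[ u < n ] 𝟙 (adj G w u ∧ not (near r v u)) ≤ d) →
    size G (suc r) v ≤ size G r v + d * ∑[ w < n ] 𝟙 (F w)
  size-suc≤ r v F d cover few = begin
    size G (suc r) v
      ≡⟨ trans (size≡∑ (suc r) v) (∑𝟙-split (near (suc r) v) (near r v)) ⟩
    ∑[ u < n ] 𝟙 (near (suc r) v u ∧ near r v u) + ∑[ u < n ] 𝟙 (layer r v u)
      ≤⟨ +-mono-≤ (∑𝟙-mono _ (near r v) (λ u → T-∧ʳ (near (suc r) v u)))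
                  (union-bound F (layer r v) (adj G) cover) ⟩
    ∑[ u < n ] 𝟙 (near r v u) + ∑[ w < n ] (𝟙 (F w) * ∑[ u < n ] 𝟙 (adj G w u ∧ layer r v u))
      ≤⟨ +-mono-≤ (≤-reflexive (sym (size≡∑ r v))) (∑-mono-≤ (λ w → 𝟙-*-≤ (F w) (few′ w))) ⟩
    size G r v + ∑[ w < n ] (d * 𝟙 (F w))
      ≡⟨ cong (size G r v +_) (sym (*-distribˡ-sum d (λ w → 𝟙 (F w)))) ⟩
    size G r v + d * ∑[ w < n ] 𝟙 (F w) ∎
    where
    open ≤-Reasoning
    inLayer : ∀ w u → T (adj G w u ∧ layer r v u) → T (adj G w u ∧ not (near r v u))
    inLayer w u t = Equivalence.from T-∧ (T-∧ˡ (adj G w u) t , T-∧ʳ (near (suc r) v u) (T-∧ʳ (adj G w u) t))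
    few′ : ∀ w → T (F w) → ∑[ u < n ] 𝟙 (adj G w u ∧ layer r v u) ≤ d
    few′ w Fw = ≤-trans (∑𝟙-mono _ _ (inLayer w)) (few w Fw)

  size-zero : ∀ v → size G 0 v ≡ 1
  size-zero v = ∣⁅x⁆∣≡1 v

  size-one≤ : ∀ v → size G 1 v ≤ 1 + maxDeg G
  size-one≤ v = begin
    size G 1 v
      ≤⟨ size-suc≤ 0 v (near 0 v) (maxDeg G) (layer-cover 0 v) few ⟩
    size G 0 v + maxDeg G * ∑[ w < n ] 𝟙 (near 0 v w)
      ≡⟨ cong₂ (λ a b → a + maxDeg G * b) (size-zero v) (trans (sym (size≡∑ 0 v)) (size-zero v)) ⟩
    1 + maxDeg G * 1
      ≡⟨ cong (1 +_) (*-identityʳ (maxDeg G)) ⟩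
    1 + maxDeg G ∎
    where
    open ≤-Reasoning
    few : ∀ w → T (near 0 v w) → ∑[ u < n ] 𝟙 (adj G w u ∧ not (near 0 v u)) ≤ maxDeg G
    few w _ = begin
      ∑[ u < n ] 𝟙 (adj G w u ∧ not (near 0 v u)) ≤⟨ ∑𝟙-mono _ (adj G w) (λ u → T-∧ˡ (adj G w u)) ⟩
      ∑[ u < n ] 𝟙 (adj G w u)                    ≡⟨ degree≡∑ w ⟨
      degree G w                                  ≤⟨ degree≤maxDeg w ⟩
      maxDeg G                                    ∎

  -- A vertex in the outer layer has its predecessor inside the ball, so only Δ - 1 edges lead further out.
  size-suc-suc≤ : 1 ≤ maxDeg G → ∀ r v → size G (suc (suc r)) v ≤ maxDeg G * size G (suc r) v
  size-suc-suc≤ Δ≥1 r v = begin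
    size G (suc (suc r)) v
      ≤⟨ size-suc≤ (suc r) v (layer r v) (maxDeg G ∸ 1) cover few ⟩
    size G (suc r) v + (maxDeg G ∸ 1) * ∑[ w < n ] 𝟙 (layer r v w)
      ≤⟨ +-monoʳ-≤ (size G (suc r) v) (*-monoʳ-≤ (maxDeg G ∸ 1) layer≤ball) ⟩
    size G (suc r) v + (maxDeg G ∸ 1) * size G (suc r) v
      ≡⟨ cong (_* size G (suc r) v) (m+[n∸m]≡n Δ≥1) ⟩
    maxDeg G * size G (suc r) v ∎
    where
    open ≤-Reasoning
    layer≤ball : ∑[ w < n ] 𝟙 (layer r v w) ≤ size G (suc r) v
    layer≤ball = ≤-trans (∑𝟙-mono (layer r v) _ (λ w t → proj₁ (∧-not⁻ t)))
                         (≤-reflexive (sym (size≡∑ (suc r) v)))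
    cover : ∀ u → T (layer (suc r) v u) → ∃[ w ] (T (layer r v w) × Adj w u)
    cover u t with layer-cover (suc r) v u t
    ... | w , x , a = w , ∧-not⁺ x (λ y → proj₂ (∧-not⁻ t) (near-suc⁺ {r} {v} {u} (inj₂ (w , y , a)))) , a
    few : ∀ w → T (layer r v w) → ∑[ u < n ] 𝟙 (adj G w u ∧ not (near (suc r) v u)) ≤ maxDeg G ∸ 1
    few w t with layer-cover r v w t
    ... | x , y , a = outside-neighbours≤ (near (suc r) v) (Adj-sym a) (near-suc⁺ {r} {v} {x} (inj₁ y))

  size≤2*Δ^r : 1 ≤ maxDeg G → ∀ r v → size G r v ≤ 2 * maxDeg G ^ r
  size≤2*Δ^r Δ≥1 zero          v = ≤-trans (≤-reflexive (size-zero v)) (s≤s z≤n)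
  size≤2*Δ^r Δ≥1 (suc zero)    v =
    ≤-trans (size-one≤ v) (≤-trans (+-monoˡ-≤ (maxDeg G) Δ≥1) (≤-reflexive (x+x≡2*x^1 (maxDeg G))))
    where
    x+x≡2*x^1 : ∀ x → x + x ≡ 2 * x ^ 1
    x+x≡2*x^1 x = cong₂ _+_ (sym (*-identityʳ x)) (sym (trans (+-identityʳ (x * 1)) (*-identityʳ x)))
  size≤2*Δ^r Δ≥1 (suc (suc r)) v = begin
    size G (suc (suc r)) v            ≤⟨ size-suc-suc≤ Δ≥1 r v ⟩
    maxDeg G * size G (suc r) v        ≤⟨ *-monoʳ-≤ (maxDeg G) (size≤2*Δ^r Δ≥1 (suc r) v) ⟩
    maxDeg G * (2 * maxDeg G ^ suc r)  ≡⟨ x*[2*y]≡2*[x*y] (maxDeg G) (maxDeg G ^ suc r) ⟩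
    2 * maxDeg G ^ suc (suc r)         ∎
    where
    open ≤-Reasoning
    x*[2*y]≡2*[x*y] : ∀ x y → x * (2 * y) ≡ 2 * (x * y)
    x*[2*y]≡2*[x*y] = solve-∀

  -- Greedy-Ratio

  module _ (r : ℕ) where

    covered : Subset n → Fin n → Bool
    covered D = lookup (ballSet G r D)

    covered⁻ : ∀ D u → T (covered D u) → ∃[ x ] (T (lookup D x) × T (near r x u))
    covered⁻ D u t with Equivalence.to (T-any-allFin _) (subst T (lookup∘tabulate _ u) t)
    ... | x , y = x , Equivalence.to T-∧ y

    covered⁺ : ∀ D {x u} → T (lookup D x) → T (near r x u) → T (covered D u)
    covered⁺ D {x} {u} Dx y = subst T (sym (lookup∘tabulate _ u))
      (Equivalence.from (T-any-allFin _) (x , Equivalence.from T-∧ (Dx , y)))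

    dominating⁻ : ∀ D → Dominating G r D → ∀ u → T (covered D u)
    dominating⁻ D dom u = Equivalence.to ∈⇔T-lookup (dom u)

    dominating⁺ : ∀ D → (∀ u → T (covered D u)) → Dominating G r D
    dominating⁺ D all u = Equivalence.from ∈⇔T-lookup (all u)

    uncovered : Subset n → ℕ
    uncovered D = ∑[ u < n ] 𝟙 (not (covered D u))

    gain≡∑ : ∀ D v → gain G r D v ≡ ∑[ u < n ] 𝟙 (near r v u ∧ not (covered D u))
    gain≡∑ D v = trans (∣p∣≡∑𝟙 (ball G r v ─ ballSet G r D))
                       (sum-cong-≗ (λ u → cong 𝟙 (lookup-─ (ball G r v) (ballSet G r D) u)))

    congestion≡∑ : ∀ S → congestion G r S ≡ ∑[ w < n ] ∑[ x < n ] 𝟙 (near r w x ∧ lookup S x)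
    congestion≡∑ S = begin
      congestion G r S                                    ≡⟨ cong sum (map-tabulate (λ w → w) f) ⟩
      sum (tabulate f)                                    ≡⟨ ∑-tabulate f ⟩
      ∑[ w < n ] f w                                      ≡⟨ sum-cong-≗ f≡∑ ⟩
      ∑[ w < n ] ∑[ x < n ] 𝟙 (near r w x ∧ lookup S x)   ∎
      where
      open ≡-Reasoning
      f : Fin n → ℕ
      f w = ∣ ball G r w ∩ S ∣
      f≡∑ : ∀ w → f w ≡ ∑[ x < n ] 𝟙 (near r w x ∧ lookup S x)
      f≡∑ w = trans (∣p∣≡∑𝟙 (ball G r w ∩ S)) (sum-cong-≗ (λ x → cong 𝟙 (lookup-∩ (ball G r w) S x)))

    -- Double counting: by symmetry of distance, each x ∈ S lies in exactly size r x of the balls.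
    congestion≡weight : ∀ S → congestion G r S ≡ weight (size G r) S
    congestion≡weight S = begin
      congestion G r S
        ≡⟨ congestion≡∑ S ⟩
      ∑[ w < n ] ∑[ x < n ] 𝟙 (near r w x ∧ lookup S x)
        ≡⟨ ∑-comm (λ w x → 𝟙 (near r w x ∧ lookup S x)) ⟩
      ∑[ x < n ] ∑[ w < n ] 𝟙 (near r w x ∧ lookup S x)
        ≡⟨ sum-cong-≗ (λ x → sum-cong-≗ (λ w → swap x w)) ⟩
      ∑[ x < n ] ∑[ w < n ] (𝟙 (lookup S x) * 𝟙 (near r x w))
        ≡⟨ sum-cong-≗ (λ x → sym (*-distribˡ-sum (𝟙 (lookup S x)) (λ w → 𝟙 (near r x w)))) ⟩
      ∑[ x < n ] (𝟙 (lookup S x) * ∑[ w < n ] 𝟙 (near r x w))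
        ≡⟨ sum-cong-≗ (λ x → cong (𝟙 (lookup S x) *_) (sym (size≡∑ r x))) ⟩
      weight (size G r) S ∎
      where
      open ≡-Reasoning
      swap : ∀ x w → 𝟙 (near r w x ∧ lookup S x) ≡ 𝟙 (lookup S x) * 𝟙 (near r x w)
      swap x w = trans (𝟙-∧ (near r w x) (lookup S x))
                       (trans (*-comm (𝟙 (near r w x)) _) (cong (𝟙 (lookup S x) *_) (𝟙-cong (near-sym r) (near-sym r))))

    congestion-∪⁅⁆ : ∀ D v → congestion G r (D ∪ ⁅ v ⁆) ≤ congestion G r D + size G r v
    congestion-∪⁅⁆ D v = begin
      congestion G r (D ∪ ⁅ v ⁆)
        ≡⟨ congestion≡weight (D ∪ ⁅ v ⁆) ⟩
      weight (size G r) (D ∪ ⁅ v ⁆)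
        ≤⟨ weight-∪ (size G r) D ⁅ v ⁆ ⟩
      weight (size G r) D + weight (size G r) ⁅ v ⁆
        ≡⟨ cong₂ _+_ (sym (congestion≡weight D)) (weight-⁅⁆ (size G r) v) ⟩
      congestion G r D + size G r v ∎
      where open ≤-Reasoning

    congestion-⊥ : congestion G r ⊥ ≡ 0
    congestion-⊥ = trans (congestion≡weight ⊥) (weight-⊥ (size G r))

    n≤congestion : ∀ S → Dominating G r S → n ≤ congestion G r S
    n≤congestion S dom = begin
      n                                                   ≡⟨ sym (trans (∑-const n 1) (*-identityʳ n)) ⟩
      ∑[ w < n ] 1                                        ≤⟨ ∑-mono-≤ hit ⟩
      ∑[ w < n ] ∑[ x < n ] 𝟙 (near r w x ∧ lookup S x)   ≡⟨ sym (congestion≡∑ S) ⟩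
      congestion G r S                                    ∎
      where
      open ≤-Reasoning
      hit : ∀ w → 1 ≤ ∑[ x < n ] 𝟙 (near r w x ∧ lookup S x)
      hit w with covered⁻ S w (dominating⁻ S dom w)
      ... | x , Sx , y = T⇒1≤∑𝟙 (λ x → near r w x ∧ lookup S x) x (Equivalence.from T-∧ (near-sym r y , Sx))

    uncovered≤weight-gain : ∀ S → Dominating G r S → ∀ D → uncovered D ≤ weight (gain G r D) S
    uncovered≤weight-gain S dom D = begin
      uncovered D
        ≤⟨ union-bound (lookup S) (λ u → not (covered D u)) (near r) cover ⟩
      ∑[ x < n ] (𝟙 (lookup S x) * ∑[ u < n ] 𝟙 (near r x u ∧ not (covered D u)))
        ≡⟨ sum-cong-≗ (λ x → cong (𝟙 (lookup S x) *_) (sym (gain≡∑ D x))) ⟩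
      weight (gain G r D) S ∎
      where
      open ≤-Reasoning
      cover : ∀ u → T (not (covered D u)) → ∃[ x ] (T (lookup S x) × T (near r x u))
      cover u _ = covered⁻ S u (dominating⁻ S dom u)

    -- The balls around S cover all uncovered vertices, and no x ∈ S has a better ratio than v.
    greedy-price : ∀ S → Dominating G r S → ∀ {D v} → MaximisesRatio G r D v →
      size G r v * uncovered D ≤ gain G r D v * congestion G r S
    greedy-price S dom {D} {v} maximal = begin
      size G r v * uncovered D                         ≤⟨ *-monoʳ-≤ (size G r v) (uncovered≤weight-gain S dom D) ⟩
      size G r v * weight (gain G r D) S               ≡⟨ *-weight (size G r v) (gain G r D) S ⟩
      weight (λ x → size G r v * gain G r D x) S       ≤⟨ weight-mono v-maximal S ⟩
      weight (λ x → gain G r D v * size G r x) S       ≡⟨ sym (*-weight (gain G r D v) (size G r) S) ⟩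
      gain G r D v * weight (size G r) S               ≡⟨ cong (gain G r D v *_) (sym (congestion≡weight S)) ⟩
      gain G r D v * congestion G r S                  ∎
      where
      open ≤-Reasoning
      v-maximal : ∀ x → size G r v * gain G r D x ≤ gain G r D v * size G r x
      v-maximal x = ≤-trans (≤-reflexive (*-comm (size G r v) (gain G r D x))) (maximal x)

    uncovered-∪⁅⁆ : ∀ D v → uncovered (D ∪ ⁅ v ⁆) + gain G r D v ≤ uncovered D
    uncovered-∪⁅⁆ D v = begin
      uncovered D′ + gain G r D v
        ≡⟨ cong (uncovered D′ +_) (gain≡∑ D v) ⟩
      uncovered D′ + ∑[ u < n ] 𝟙 (near r v u ∧ not (covered D u))
        ≡⟨ sym (∑-distrib-+ (λ u → 𝟙 (not (covered D′ u))) (λ u → 𝟙 (near r v u ∧ not (covered D u)))) ⟩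
      ∑[ u < n ] (𝟙 (not (covered D′ u)) + 𝟙 (near r v u ∧ not (covered D u)))
        ≤⟨ ∑-mono-≤ (λ u → 𝟙-disjoint _ _ _ (still u) (new u) (apart u)) ⟩
      uncovered D ∎
      where
      open ≤-Reasoning
      D′ = D ∪ ⁅ v ⁆
      v∈D′ : T (lookup D′ v)
      v∈D′ = subst T (sym (lookup-∪ D ⁅ v ⁆ v))
                     (Equivalence.from T-∨ (inj₂ (Equivalence.to ∈⇔T-lookup (x∈⁅x⁆ v))))
      covered-∪ : ∀ u → T (covered D u) → T (covered D′ u)
      covered-∪ u t with covered⁻ D u t
      ... | x , Dx , y = covered⁺ D′ (subst T (sym (lookup-∪ D ⁅ v ⁆ x)) (Equivalence.from T-∨ (inj₁ Dx))) y
      still : ∀ u → T (not (covered D′ u)) → T (not (covered D u))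
      still u t = ¬T⇒T-not (λ c → T-not⇒¬T t (covered-∪ u c))
      new : ∀ u → T (near r v u ∧ not (covered D u)) → T (not (covered D u))
      new u = T-∧ʳ (near r v u)
      apart : ∀ u → T (not (covered D′ u)) → ¬ T (near r v u ∧ not (covered D u))
      apart u t s = T-not⇒¬T t (covered⁺ D′ v∈D′ (T-∧ˡ (near r v u) s))

    some-uncovered : ∀ D → ¬ Dominating G r D → ∃[ u ] ¬ T (covered D u)
    some-uncovered D ¬dom =
      ¬∀⟶∃¬ n (λ u → T (covered D u)) (λ u → T? (covered D u)) (λ all → ¬dom (dominating⁺ D all))

    uncovered-pos : ∀ D → ¬ Dominating G r D → 1 ≤ uncovered D
    uncovered-pos D ¬dom with some-uncovered D ¬dom
    ... | u , ¬cu = T⇒1≤∑𝟙 (λ u → not (covered D u)) u (¬T⇒T-not ¬cu)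

    size-pos : ∀ v → 1 ≤ size G r v
    size-pos v = subst (1 ≤_) (sym (size≡∑ r v)) (T⇒1≤∑𝟙 (near r v) v (near-refl r v))

    gain-pos : ∀ {D v} → ¬ Dominating G r D → MaximisesRatio G r D v → 1 ≤ gain G r D v
    gain-pos {D} {v} ¬dom maximal with some-uncovered D ¬dom
    ... | u , ¬cu = 1≤m*n⇒1≤m (≤-trans (*-mono-≤ gain-u (size-pos v)) (maximal u))
      where
      gain-u : 1 ≤ gain G r D u
      gain-u = subst (1 ≤_) (sym (gain≡∑ D u)) (T⇒1≤∑𝟙 _ u (∧-not⁺ (near-refl r u) ¬cu))
      1≤m*n⇒1≤m : ∀ {m k} → 1 ≤ m * k → 1 ≤ m
      1≤m*n⇒1≤m {suc m} _ = s≤s z≤n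

    size≤K*gain : ∀ S → Dominating G r S → ∀ K {D v} → ¬ Dominating G r D → MaximisesRatio G r D v →
      congestion G r S ≤ uncovered D * K → size G r v ≤ K * gain G r D v
    size≤K*gain S dom K {D} {v} ¬dom maximal early =
      *-cancelʳ-≤ (size G r v) (K * gain G r D v) (uncovered D) {{>-nonZero (uncovered-pos D ¬dom)}} (begin
        size G r v * uncovered D         ≤⟨ greedy-price S dom {D} {v} maximal ⟩
        gain G r D v * congestion G r S  ≤⟨ *-monoʳ-≤ (gain G r D v) early ⟩
        gain G r D v * (uncovered D * K) ≡⟨ reorder (gain G r D v) (uncovered D) K ⟩
        K * gain G r D v * uncovered D   ∎)
      where
      open ≤-Reasoning
      reorder : ∀ g u k → g * (u * k) ≡ k * g * u
      reorder = solve-∀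

    greedy-dominates : ∀ {D out} → GreedyRun G r D out → Dominating G r out
    greedy-dominates (done dom)      = dom
    greedy-dominates (add _ _ _ run) = greedy-dominates run

    module _ (B : ℕ) (size≤B : ∀ v → size G r v ≤ B) where

      greedy-congestion≤ : ∀ {D out} → GreedyRun G r D out → congestion G r out ≤ congestion G r D + B * uncovered D
      greedy-congestion≤ {D} (done _) = m≤m+n _ _
      greedy-congestion≤ {D} {out} (add v ¬dom maximal run) = begin
        congestion G r out
          ≤⟨ greedy-congestion≤ run ⟩
        congestion G r D′ + B * uncovered D′
          ≤⟨ +-monoˡ-≤ _ (congestion-∪⁅⁆ D v) ⟩
        congestion G r D + size G r v + B * uncovered D′
          ≤⟨ +-monoˡ-≤ _ (+-monoʳ-≤ (congestion G r D) size≤B*gain) ⟩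
        congestion G r D + B * gain G r D v + B * uncovered D′
          ≡⟨ regroup (congestion G r D) B (gain G r D v) (uncovered D′) ⟩
        congestion G r D + B * (uncovered D′ + gain G r D v)
          ≤⟨ +-monoʳ-≤ (congestion G r D) (*-monoʳ-≤ B (uncovered-∪⁅⁆ D v)) ⟩
        congestion G r D + B * uncovered D ∎
        where
        open ≤-Reasoning
        D′ = D ∪ ⁅ v ⁆
        size≤B*gain : size G r v ≤ B * gain G r D v
        size≤B*gain = ≤-trans (size≤B v)
          (≤-trans (≤-reflexive (sym (*-identityʳ B))) (*-monoʳ-≤ B (gain-pos {D} {v} ¬dom maximal)))
        regroup : ∀ c b g u → c + b * g + b * u ≡ c + b * (u + g)
        regroup = solve-∀

      -- While at least (congestion of S) / K vertices are uncovered, a step costs at most K per newly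
      -- covered vertex; afterwards the remaining cost is at most B per uncovered vertex.
      greedy-congestion≤-threshold : ∀ S → Dominating G r S → ∀ K {D out} → GreedyRun G r D out →
        K * congestion G r out ≤ K * congestion G r D + K * K * uncovered D + B * congestion G r S
      greedy-congestion≤-threshold S dom K {D} (done _) = ≤-trans (m≤m+n _ _) (m≤m+n _ _)
      greedy-congestion≤-threshold S dom K {D} {out} (add v ¬dom maximal run) with congestion G r S ≤? uncovered D * K
      ... | yes early = begin
        K * congestion G r out
          ≤⟨ greedy-congestion≤-threshold S dom K run ⟩
        K * congestion G r D′ + K * K * uncovered D′ + B * O
          ≤⟨ +-monoˡ-≤ _ (+-monoˡ-≤ _ (*-monoʳ-≤ K (congestion-∪⁅⁆ D v))) ⟩
        K * (congestion G r D + size G r v) + K * K * uncovered D′ + B * O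
          ≤⟨ +-monoˡ-≤ _ (+-monoˡ-≤ _ (*-monoʳ-≤ K (+-monoʳ-≤ (congestion G r D) (size≤K*gain S dom K {D} {v} ¬dom maximal early)))) ⟩
        K * (congestion G r D + K * gain G r D v) + K * K * uncovered D′ + B * O
          ≡⟨ regroup K (congestion G r D) (gain G r D v) (uncovered D′) (B * O) ⟩
        K * congestion G r D + K * K * (uncovered D′ + gain G r D v) + B * O
          ≤⟨ +-monoˡ-≤ (B * O) (+-monoʳ-≤ (K * congestion G r D) (*-monoʳ-≤ (K * K) (uncovered-∪⁅⁆ D v))) ⟩
        K * congestion G r D + K * K * uncovered D + B * O ∎
        where
        open ≤-Reasoning
        D′ = D ∪ ⁅ v ⁆
        O = congestion G r S
        regroup : ∀ k c g u o → k * (c + k * g) + k * k * u + o ≡ k * c + k * k * (u + g) + o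
        regroup = solve-∀
      ... | no late = begin
        K * congestion G r out
          ≤⟨ *-monoʳ-≤ K (greedy-congestion≤ (add v ¬dom maximal run)) ⟩
        K * (congestion G r D + B * uncovered D)
          ≡⟨ regroup K (congestion G r D) B (uncovered D) ⟩
        K * congestion G r D + B * (uncovered D * K)
          ≤⟨ +-monoʳ-≤ _ (*-monoʳ-≤ B (<⇒≤ (≰⇒> late))) ⟩
        K * congestion G r D + B * congestion G r S
          ≤⟨ +-monoˡ-≤ (B * congestion G r S) (m≤m+n (K * congestion G r D) (K * K * uncovered D)) ⟩
        K * congestion G r D + K * K * uncovered D + B * congestion G r S ∎
        where
        open ≤-Reasoning
        regroup : ∀ k c b u → k * (c + b * u) ≡ k * c + b * (u * k)
        regroup = solve-∀

      greedy-congestion≤2K : ∀ S → Dominating G r S → ∀ K .{{_ : NonZero K}} → B ≤ K * K →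
        ∀ {D} → GreedyRun G r ⊥ D → congestion G r D ≤ 2 * K * congestion G r S
      greedy-congestion≤2K S dom K B≤K² {D} run = *-cancelˡ-≤ K (begin
        K * congestion G r D
          ≤⟨ greedy-congestion≤-threshold S dom K run ⟩
        K * congestion G r ⊥ + K * K * uncovered ⊥ + B * O
          ≡⟨ cong (λ c → K * c + K * K * uncovered ⊥ + B * O) congestion-⊥ ⟩
        K * 0 + K * K * uncovered ⊥ + B * O
          ≤⟨ +-mono-≤ (+-monoʳ-≤ (K * 0) (*-monoʳ-≤ (K * K) U≤O)) (*-monoˡ-≤ O B≤K²) ⟩
        K * 0 + K * K * O + K * K * O
          ≡⟨ collect K O ⟩
        K * (2 * K * O) ∎)
        where
        open ≤-Reasoning
        O = congestion G r S
        U≤O : uncovered ⊥ ≤ O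
        U≤O = ≤-trans (∑𝟙≤n (λ u → not (covered ⊥ u))) (n≤congestion S dom)
        collect : ∀ k o → k * 0 + k * k * o + k * k * o ≡ k * (2 * k * o)
        collect = solve-∀

square-between : ∀ N → 1 ≤ N → ∃[ K ] (1 ≤ K × N ≤ K * K × K * K ≤ 4 * N)
square-between (suc N) _ = go N
  where
  go : ∀ N → ∃[ K ] (1 ≤ K × suc N ≤ K * K × K * K ≤ 4 * suc N)
  go zero = 1 , ≤-refl , ≤-refl , s≤s z≤n
  go (suc N) with go N
  ... | K , 1≤K , lo , hi with suc (suc N) ≤? K * K
  ...   | yes lo′ = K , 1≤K , lo′ , ≤-trans hi (*-monoʳ-≤ 4 (n≤1+n (suc N)))
  ...   | no ¬lo′ = suc K , s≤s z≤n , lo″ , hi″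
    where
    open ≤-Reasoning
    expand : ∀ k → suc k * suc k ≡ k * k + (k + k + 1)
    expand = solve-∀
    lo″ : suc (suc N) ≤ suc K * suc K
    lo″ = begin
      suc (suc N)            ≡⟨ +-comm 1 (suc N) ⟩
      suc N + 1              ≤⟨ +-mono-≤ lo (m≤n+m 1 (K + K)) ⟩
      K * K + (K + K + 1)    ≡⟨ sym (expand K) ⟩
      suc K * suc K          ∎
    double : ∀ k → 1 ≤ k → suc k * suc k ≤ 4 * (k * k)
    double (suc k) _ = ≤-trans (m≤m+n _ (3 * k * k + 4 * k)) (≤-reflexive (identity k))
      where
      identity : ∀ k → suc (suc k) * suc (suc k) + (3 * k * k + 4 * k) ≡ 4 * (suc k * suc k)
      identity = solve-∀
    hi″ : suc K * suc K ≤ 4 * suc (suc N)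
    hi″ = begin
      suc K * suc K          ≤⟨ double K 1≤K ⟩
      4 * (K * K)            ≤⟨ *-monoʳ-≤ 4 (≤-pred (≰⇒> ¬lo′)) ⟩
      4 * suc N              ≤⟨ *-monoʳ-≤ 4 (n≤1+n (suc N)) ⟩
      4 * suc (suc N)        ∎

squared-bound : ∀ {a o d K} → a ≤ 2 * K * o → K * K ≤ 4 * (2 * d) → a ^ 2 ≤ (6 ^ 2 * d) * o ^ 2
squared-bound {a} {o} {d} {K} a≤2Ko K²≤8d = begin
  a ^ 2                      ≤⟨ ^-monoˡ-≤ 2 a≤2Ko ⟩
  (2 * K * o) ^ 2            ≡⟨ expand K o ⟩
  4 * (K * K) * o ^ 2        ≤⟨ *-monoˡ-≤ (o ^ 2) (*-monoʳ-≤ 4 K²≤8d) ⟩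
  4 * (4 * (2 * d)) * o ^ 2  ≡⟨ cong (_* o ^ 2) (thirty-two d) ⟩
  32 * d * o ^ 2             ≤⟨ *-monoˡ-≤ (o ^ 2) (*-monoˡ-≤ d (m≤m+n 32 4)) ⟩
  (6 ^ 2 * d) * o ^ 2        ∎
  where
  open ≤-Reasoning
  expand : ∀ k o → (2 * k * o) * ((2 * k * o) * 1) ≡ 4 * (k * k) * (o * (o * 1))
  expand = solve-∀
  thirty-two : ∀ d → 4 * (4 * (2 * d)) ≡ 32 * d
  thirty-two = solve-∀

greedy-congestion²≤ : ∀ {n} (G : Graph n) r → 1 ≤ maxDeg G → ∀ S → Dominating G r S →
  ∀ {D} → GreedyRun G r ⊥ D → congestion G r D ^ 2 ≤ (6 ^ 2 * maxDeg G ^ r) * congestion G r S ^ 2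
greedy-congestion²≤ G r Δ≥1 S dom run
  with square-between (2 * maxDeg G ^ r) (≤-trans (m^n>0 (maxDeg G) {{>-nonZero Δ≥1}} r) (m≤m+n _ _))
... | K , 1≤K , B≤K² , K²≤4B = squared-bound {d = maxDeg G ^ r} {K}
  (greedy-congestion≤2K G r (2 * maxDeg G ^ r) (size≤2*Δ^r G Δ≥1 r) S dom K {{>-nonZero 1≤K}} B≤K² run) K²≤4B

theorem3p7 : Σ[ C ∈ ℕ ] (∀ (n : ℕ) (G : Graph n) (r : ℕ) (D : Subset n) →
    1 ≤ maxDeg G → GreedyRun G r ⊥ D →
    Dominating G r D
    × (∀ (m : ℕ) → IsMinCongestion G r m →
         congestion G r D ^ 2 ≤ (C ^ 2 * maxDeg G ^ r) * m ^ 2))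
theorem3p7 = 6 , λ n G r D Δ≥1 run →
  greedy-dominates G r run ,
  λ { m ((S , dom , refl) , _) → greedy-congestion²≤ G r Δ≥1 S dom run }
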